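{- Let $\mathbf A$ be an MTL-algebra and let $\mathfrak a$ be a prime filter of $\mathbf A$. Then $\mathfrak a^*$ is the largest prime filter $\mathfrak b$ of $\mathbf A$ such that $\mathfrak a\bullet\mathfrak b\neq A$.
   Context: **MTL-algebras.** An MTL-algebra is a bounded commutative integral residuated lattice $(A,\wedge,\vee,\cdot,\to,0,1)$ with distributive lattice reduct satisfying $(a\to b)\vee(b\to a)=1$. Write $\neg a=a\to0$. **Filters.** - A prime filter is a proper lattice filter $F$ with $a\vee b\in F\Rightarrow a\in F$ or $b\in F$. - $\mathfrak a\bullet\mathfrak b=\{c:\exists a\in\mathfrak a,\ b\in\mathfrak b,\ a\cdot b\le c\}$. - The Routley star is $\mathfrak a^*=\{a\in A:\neg a\notin\mathfrak a\}$; it is a prime filter when $\mathfrak a$ is. -}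

module Defs where

open import Level using (Level; suc; _⊔_)
open import Data.Product using (Σ; _×_; _,_; ∃-syntax)
open import Data.Sum using (_⊎_)
open import Relation.Nullary using (¬_)
open import Relation.Binary.PropositionalEquality using (_≡_)

record MTLAlgebra (ℓ : Level) : Set (suc ℓ) where
  infixr 6 _∨_
  infixr 7 _∧_
  infixr 8 _·_
  infixr 5 _⇒_
  field
    Carrier : Set ℓ
    _∧_ _∨_ _·_ _⇒_ : Carrier → Carrier → Carrier
    𝟘 𝟙 : Carrier
    ∧-comm  : ∀ a b → a ∧ b ≡ b ∧ a
    ∨-comm  : ∀ a b → a ∨ b ≡ b ∨ a
    ∧-assoc : ∀ a b c → (a ∧ b) ∧ c ≡ a ∧ (b ∧ c)
    ∨-assoc : ∀ a b c → (a ∨ b) ∨ c ≡ a ∨ (b ∨ c)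
    ∧-absorbs-∨ : ∀ a b → a ∧ (a ∨ b) ≡ a
    ∨-absorbs-∧ : ∀ a b → a ∨ (a ∧ b) ≡ a
    ∧-distrib-∨ : ∀ a b c → a ∧ (b ∨ c) ≡ (a ∧ b) ∨ (a ∧ c)
    𝟘-least  : ∀ a → 𝟘 ∧ a ≡ 𝟘
    𝟙-greatest : ∀ a → a ∧ 𝟙 ≡ a
    -- commutative monoid (·, 𝟙); integrality is 𝟙 being the top
    ·-comm  : ∀ a b → a · b ≡ b · a
    ·-assoc : ∀ a b c → (a · b) · c ≡ a · (b · c)
    ·-identity : ∀ a → a · 𝟙 ≡ a
    -- residuation: a · b ≤ c  iff  a ≤ b ⇒ c  (x ≤ y encoded as x ∧ y ≡ x)
    residuation₁ : ∀ a b c → (a · b) ∧ c ≡ a · b → a ∧ (b ⇒ c) ≡ a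
    residuation₂ : ∀ a b c → a ∧ (b ⇒ c) ≡ a → (a · b) ∧ c ≡ a · b
    prelinear : ∀ a b → (a ⇒ b) ∨ (b ⇒ a) ≡ 𝟙

  _≤_ : Carrier → Carrier → Set ℓ
  a ≤ b = a ∧ b ≡ a

  ¬ₐ_ : Carrier → Carrier
  ¬ₐ a = a ⇒ 𝟘

module _ {ℓ : Level} (A : MTLAlgebra ℓ) where
  open MTLAlgebra A

  Subset : Set (suc ℓ)
  Subset = Carrier → Set ℓ

  _⊆_ : Subset → Subset → Set ℓ
  F ⊆ G = ∀ a → F a → G a

  record IsFilter (F : Subset) : Set ℓ where
    field
      contains-𝟙 : F 𝟙
      upward     : ∀ a b → a ≤ b → F a → F b
      ∧-closed   : ∀ a b → F a → F b → F (a ∧ b)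

  record IsPrimeFilter (F : Subset) : Set ℓ where
    field
      isFilter : IsFilter F
      proper   : ¬ (∀ a → F a)
      prime    : ∀ a b → F (a ∨ b) → F a ⊎ F b

  _•_ : Subset → Subset → Subset
  (𝔞 • 𝔟) c = ∃[ a ] ∃[ b ] (𝔞 a × 𝔟 b × (a · b) ≤ c)

  star : Subset → Subset
  star 𝔞 a = ¬ 𝔞 (¬ₐ a)

  NotWhole : Subset → Set ℓ
  NotWhole S = ¬ (∀ c → S c)

  IsLargestPrimeFilterWith : (Subset → Set ℓ) → Subset → Set (suc ℓ)
  IsLargestPrimeFilterWith P 𝔟 =
    IsPrimeFilter 𝔟 × P 𝔟 × (∀ 𝔠 → IsPrimeFilter 𝔠 → P 𝔠 → 𝔠 ⊆ 𝔟)

-- The star of a prime filter 𝔞 is again a prime filter: closure under ∧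
-- rests on ¬(a ∧ b) ≤ ¬a ∨ ¬b, which is where prelinearity enters, and
-- primality (classically) on ¬a ∧ ¬b ≤ ¬(a ∨ b). Any 𝔟 with
-- 𝔞 • 𝔟 ≠ A cannot contain any c with ¬c ∈ 𝔞, because ¬c · c ≤ 𝟘 would put
-- every element into 𝔞 • 𝔟; so 𝔟 ⊆ 𝔞*. Conversely a ∈ 𝔞 and b ∈ 𝔞* with
-- a · b ≤ 𝟘 is impossible, since then a ≤ ¬b ∈ 𝔞, so 𝔞 • 𝔞* ≠ A.
module Submission where

open import Defs
open import Level using (Level)
open import Axiom.ExcludedMiddle using (ExcludedMiddle)
open import Data.Product using (_,_)
open import Data.Sum using (_⊎_; inj₁; inj₂; [_,_])
open import Relation.Nullary using (¬_; yes; no; contradiction)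
open import Relation.Binary.Bundles using (Poset)
open import Relation.Binary.PropositionalEquality
  using (_≡_; refl; sym; trans; cong; subst; subst₂; isEquivalence; module ≡-Reasoning)
import Relation.Binary.Reasoning.PartialOrder as PartialOrderReasoning

module MTLProperties {ℓ : Level} (A : MTLAlgebra ℓ) where
  open MTLAlgebra A renaming (_≤_ to infix 4 _≤_; ¬ₐ_ to infix 9 ¬ₐ_)

  ∧-idem : ∀ a → a ∧ a ≡ a
  ∧-idem a = trans (cong (a ∧_) (sym (∨-absorbs-∧ a a))) (∧-absorbs-∨ a (a ∧ a))

  ≤-reflexive : ∀ {a b} → a ≡ b → a ≤ b
  ≤-reflexive {a} refl = ∧-idem a

  ≤-trans : ∀ {a b c} → a ≤ b → b ≤ c → a ≤ c
  ≤-trans {a} {b} {c} a≤b b≤c = begin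
    a ∧ c       ≡⟨ cong (_∧ c) (sym a≤b) ⟩
    (a ∧ b) ∧ c ≡⟨ ∧-assoc a b c ⟩
    a ∧ (b ∧ c) ≡⟨ cong (a ∧_) b≤c ⟩
    a ∧ b       ≡⟨ a≤b ⟩
    a           ∎
    where open ≡-Reasoning

  ≤-antisym : ∀ {a b} → a ≤ b → b ≤ a → a ≡ b
  ≤-antisym {a} {b} a≤b b≤a = trans (sym a≤b) (trans (∧-comm a b) b≤a)

  ≤-poset : Poset ℓ ℓ ℓ
  ≤-poset = record
    { _≤_ = _≤_
    ; isPartialOrder = record
      { isPreorder = record
        { isEquivalence = isEquivalence
        ; reflexive = ≤-reflexive
        ; trans = ≤-trans
        }
      ; antisym = ≤-antisym
      }
    }

  module ≤-Reasoning = PartialOrderReasoning ≤-poset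

  x∧y≤x : ∀ a b → a ∧ b ≤ a
  x∧y≤x a b = begin
    (a ∧ b) ∧ a ≡⟨ ∧-assoc a b a ⟩
    a ∧ (b ∧ a) ≡⟨ cong (a ∧_) (∧-comm b a) ⟩
    a ∧ (a ∧ b) ≡⟨ sym (∧-assoc a a b) ⟩
    (a ∧ a) ∧ b ≡⟨ cong (_∧ b) (∧-idem a) ⟩
    a ∧ b       ∎
    where open ≡-Reasoning

  x∧y≤y : ∀ a b → a ∧ b ≤ b
  x∧y≤y a b = trans (∧-assoc a b b) (cong (a ∧_) (∧-idem b))

  ∧-greatest : ∀ {a b c} → a ≤ b → a ≤ c → a ≤ b ∧ c
  ∧-greatest {a} {b} {c} a≤b a≤c = trans (sym (∧-assoc a b c)) (trans (cong (_∧ c) a≤b) a≤c)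

  x≤x∨y : ∀ a b → a ≤ a ∨ b
  x≤x∨y = ∧-absorbs-∨

  y≤x∨y : ∀ a b → b ≤ a ∨ b
  y≤x∨y a b = subst (b ≤_) (∨-comm b a) (x≤x∨y b a)

  ∨-least : ∀ {a b c} → a ≤ c → b ≤ c → a ∨ b ≤ c
  ∨-least {a} {b} {c} a≤c b≤c = begin
    (a ∨ b) ∧ c       ≡⟨ ∧-comm (a ∨ b) c ⟩
    c ∧ (a ∨ b)       ≡⟨ ∧-distrib-∨ c a b ⟩
    (c ∧ a) ∨ (c ∧ b) ≡⟨ cong (_∨ (c ∧ b)) (trans (∧-comm c a) a≤c) ⟩
    a ∨ (c ∧ b)       ≡⟨ cong (a ∨_) (trans (∧-comm c b) b≤c) ⟩
    a ∨ b             ∎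
    where open ≡-Reasoning

  ∨-mono-≤ : ∀ {a b c d} → a ≤ c → b ≤ d → a ∨ b ≤ c ∨ d
  ∨-mono-≤ {c = c} {d} a≤c b≤d =
    ∨-least (≤-trans a≤c (x≤x∨y c d)) (≤-trans b≤d (y≤x∨y c d))

  𝟘≤x : ∀ a → 𝟘 ≤ a
  𝟘≤x = 𝟘-least

  ·≤⇒≤⇒ : ∀ {a b c} → a · b ≤ c → a ≤ b ⇒ c
  ·≤⇒≤⇒ {a} {b} {c} = residuation₁ a b c

  ≤⇒⇒·≤ : ∀ {a b c} → a ≤ b ⇒ c → a · b ≤ c
  ≤⇒⇒·≤ {a} {b} {c} = residuation₂ a b c

  modus-ponens : ∀ a b → (a ⇒ b) · a ≤ b
  modus-ponens a b = ≤⇒⇒·≤ (≤-reflexive refl)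

  ·-monoˡ-≤ : ∀ {a b} c → a ≤ b → a · c ≤ b · c
  ·-monoˡ-≤ c a≤b = ≤⇒⇒·≤ (≤-trans a≤b (·≤⇒≤⇒ (≤-reflexive refl)))

  ·-monoʳ-≤ : ∀ {a b} c → a ≤ b → c · a ≤ c · b
  ·-monoʳ-≤ {a} {b} c a≤b = subst₂ _≤_ (·-comm a c) (·-comm b c) (·-monoˡ-≤ c a≤b)

  x·y≤y : ∀ a b → a · b ≤ b
  x·y≤y a b = begin
    a · b ≤⟨ ·-monoˡ-≤ b (𝟙-greatest a) ⟩
    𝟙 · b ≡⟨ ·-comm 𝟙 b ⟩
    b · 𝟙 ≡⟨ ·-identity b ⟩
    b     ∎
    where open ≤-Reasoning

  x·[y∨z]≤x·y∨x·z : ∀ a b c → a · (b ∨ c) ≤ a · b ∨ a · c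
  x·[y∨z]≤x·y∨x·z a b c = begin
    a · (b ∨ c)   ≡⟨ ·-comm a (b ∨ c) ⟩
    (b ∨ c) · a   ≤⟨ ≤⇒⇒·≤ (∨-least (·≤⇒≤⇒ (commuted b (x≤x∨y _ _)))
                                    (·≤⇒≤⇒ (commuted c (y≤x∨y _ _)))) ⟩
    a · b ∨ a · c ∎
    where
    open ≤-Reasoning
    commuted : ∀ d → a · d ≤ a · b ∨ a · c → d · a ≤ a · b ∨ a · c
    commuted d = subst (_≤ a · b ∨ a · c) (·-comm a d)

  ¬-antitone : ∀ {a b} → a ≤ b → ¬ₐ b ≤ ¬ₐ a
  ¬-antitone {a} {b} a≤b = ·≤⇒≤⇒ (begin
    ¬ₐ b · a ≤⟨ ·-monoʳ-≤ (¬ₐ b) a≤b ⟩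
    ¬ₐ b · b ≤⟨ modus-ponens b 𝟘 ⟩
    𝟘        ∎)
    where open ≤-Reasoning

  ¬𝟙≤𝟘 : ¬ₐ 𝟙 ≤ 𝟘
  ¬𝟙≤𝟘 = subst (_≤ 𝟘) (·-identity (¬ₐ 𝟙)) (modus-ponens 𝟙 𝟘)

  𝟙≤¬𝟘 : 𝟙 ≤ ¬ₐ 𝟘
  𝟙≤¬𝟘 = ·≤⇒≤⇒ (x·y≤y 𝟙 𝟘)

  ¬[x∧y]≤¬x∨¬y : ∀ a b → ¬ₐ (a ∧ b) ≤ ¬ₐ a ∨ ¬ₐ b
  ¬[x∧y]≤¬x∨¬y a b = begin
    z                               ≡⟨ sym (·-identity z) ⟩
    z · 𝟙                           ≡⟨ cong (z ·_) (sym (prelinear a b)) ⟩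
    z · ((a ⇒ b) ∨ (b ⇒ a))         ≤⟨ x·[y∨z]≤x·y∨x·z z (a ⇒ b) (b ⇒ a) ⟩
    z · (a ⇒ b) ∨ z · (b ⇒ a)       ≤⟨ ∨-mono-≤ (to¬ (∧-greatest (x·y≤y _ a) (modus-ponens a b)))
                                                (to¬ (∧-greatest (modus-ponens b a) (x·y≤y _ b))) ⟩
    ¬ₐ a ∨ ¬ₐ b                     ∎
    where
    open ≤-Reasoning
    z = ¬ₐ (a ∧ b)
    to¬ : ∀ {u c} → u · c ≤ a ∧ b → z · u ≤ ¬ₐ c
    to¬ {u} {c} u·c≤a∧b = ·≤⇒≤⇒ (begin
      (z · u) · c ≡⟨ ·-assoc z u c ⟩
      z · (u · c) ≤⟨ ·-monoʳ-≤ z u·c≤a∧b ⟩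
      z · (a ∧ b) ≤⟨ modus-ponens (a ∧ b) 𝟘 ⟩
      𝟘           ∎)

  ¬x∧¬y≤¬[x∨y] : ∀ a b → ¬ₐ a ∧ ¬ₐ b ≤ ¬ₐ (a ∨ b)
  ¬x∧¬y≤¬[x∨y] a b = ·≤⇒≤⇒ (begin
    w · (a ∨ b)   ≤⟨ x·[y∨z]≤x·y∨x·z w a b ⟩
    w · a ∨ w · b ≤⟨ ∨-least (≤-trans (·-monoˡ-≤ a (x∧y≤x _ _)) (modus-ponens a 𝟘))
                             (≤-trans (·-monoˡ-≤ b (x∧y≤y _ _)) (modus-ponens b 𝟘)) ⟩
    𝟘             ∎)
    where
    open ≤-Reasoning
    w = ¬ₐ a ∧ ¬ₐ b

module RoutleyStar {ℓ : Level} (A : MTLAlgebra ℓ) where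
  open MTLAlgebra A renaming (_≤_ to infix 4 _≤_; ¬ₐ_ to infix 9 ¬ₐ_)
  open MTLProperties A

  module _ {𝔞 : Subset A} (𝔞-filter : IsFilter A 𝔞) where
    open IsFilter 𝔞-filter

    filter-whole-if-𝟘 : 𝔞 𝟘 → ∀ a → 𝔞 a
    filter-whole-if-𝟘 𝟘∈𝔞 a = upward 𝟘 a (𝟘≤x a) 𝟘∈𝔞

    star-upward : ∀ a b → a ≤ b → star A 𝔞 a → star A 𝔞 b
    star-upward a b a≤b ¬a∉𝔞 ¬b∈𝔞 = ¬a∉𝔞 (upward (¬ₐ b) (¬ₐ a) (¬-antitone a≤b) ¬b∈𝔞)

    star-proper : ¬ (∀ a → star A 𝔞 a)
    star-proper star-whole = star-whole 𝟘 (upward 𝟙 (¬ₐ 𝟘) 𝟙≤¬𝟘 contains-𝟙)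

    star-prime : ExcludedMiddle ℓ → ∀ a b → star A 𝔞 (a ∨ b) → star A 𝔞 a ⊎ star A 𝔞 b
    star-prime em a b ¬[a∨b]∉𝔞 with em {𝔞 (¬ₐ a)} | em {𝔞 (¬ₐ b)}
    ... | no ¬a∉𝔞 | _       = inj₁ ¬a∉𝔞
    ... | yes _   | no ¬b∉𝔞 = inj₂ ¬b∉𝔞
    ... | yes ¬a∈𝔞 | yes ¬b∈𝔞 =
      contradiction (upward _ _ (¬x∧¬y≤¬[x∨y] a b) (∧-closed _ _ ¬a∈𝔞 ¬b∈𝔞)) ¬[a∨b]∉𝔞

    •-star-notWhole : NotWhole A (_•_ A 𝔞 (star A 𝔞))
    •-star-notWhole •-whole with •-whole 𝟘
    ... | a , b , a∈𝔞 , ¬b∉𝔞 , a·b≤𝟘 = ¬b∉𝔞 (upward a (¬ₐ b) (·≤⇒≤⇒ a·b≤𝟘) a∈𝔞)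

  module _ {𝔞 : Subset A} (𝔞-prime : IsPrimeFilter A 𝔞) where
    open IsPrimeFilter 𝔞-prime
    open IsFilter isFilter

    star-contains-𝟙 : star A 𝔞 𝟙
    star-contains-𝟙 ¬𝟙∈𝔞 = proper (filter-whole-if-𝟘 isFilter (upward _ 𝟘 ¬𝟙≤𝟘 ¬𝟙∈𝔞))

    star-∧-closed : ∀ a b → star A 𝔞 a → star A 𝔞 b → star A 𝔞 (a ∧ b)
    star-∧-closed a b ¬a∉𝔞 ¬b∉𝔞 ¬[a∧b]∈𝔞 =
      [ ¬a∉𝔞 , ¬b∉𝔞 ] (prime _ _ (upward _ _ (¬[x∧y]≤¬x∨¬y a b) ¬[a∧b]∈𝔞))

    star-isPrimeFilter : ExcludedMiddle ℓ → IsPrimeFilter A (star A 𝔞)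
    star-isPrimeFilter em = record
      { isFilter = record
        { contains-𝟙 = star-contains-𝟙
        ; upward = star-upward isFilter
        ; ∧-closed = star-∧-closed
        }
      ; proper = star-proper isFilter
      ; prime = star-prime isFilter em
      }

  notWhole⇒⊆star : ∀ {𝔞} 𝔟 → NotWhole A (_•_ A 𝔞 𝔟) → _⊆_ A 𝔟 (star A 𝔞)
  notWhole⇒⊆star 𝔟 •-notWhole c c∈𝔟 ¬c∈𝔞 =
    •-notWhole (λ d → ¬ₐ c , c , ¬c∈𝔞 , c∈𝔟 , ≤-trans (modus-ponens c 𝟘) (𝟘≤x d))

open RoutleyStar

lemma3p15 : {ℓ : Level} → ExcludedMiddle ℓ → (A : MTLAlgebra ℓ) (𝔞 : Subset A) → IsPrimeFilter A 𝔞 → IsLargestPrimeFilterWith A (λ 𝔟 → NotWhole A (_•_ A 𝔞 𝔟)) (star A 𝔞)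
lemma3p15 em A 𝔞 𝔞-prime =
    star-isPrimeFilter A 𝔞-prime em
  , •-star-notWhole A (IsPrimeFilter.isFilter 𝔞-prime)
  , λ 𝔟 _ → notWhole⇒⊆star A 𝔟
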